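{- For a nonnegative integer $d$, let $$p_k(m)=\prod_{i=0}^{k-1}(m+i+1-r),\qquad g_k(u,d)=\binom{d}{k}\prod_{i=0}^{k-1}(r+i)\prod_{j=k+1}^{d}(d-j+r)(u+j+r),$$ and $\mathbf{N}^u_d(m)=\sum_{k=0}^{d}g_k(u,d)p_k(m)$. Then $$(u+d+m)(u-m+r)\,\mathbf{N}^u_d(m)=\sum_{k=0}^{d}\sum_{i=0}^{2}g_k(u,d)\,\gamma^{1,i}_k(u,d)\,p_{k+i}(m),$$ where $\gamma^{1,0}_k(u,d)=(u+d-k-1+r)(u+k+1)$, $\gamma^{1,1}_k(u,d)=2k+3-d-r$, and $\gamma^{1,2}_k(u,d)=-1$.
   Context: $r,u,m$ are indeterminates (the identity is a polynomial identity in $r,u,m$); $d$ is a nonnegative integer. -}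

module Defs where

open import Algebra.Bundles using (CommutativeRing)
open import Data.Nat as ℕ using (ℕ; zero; suc; _∸_)
open import Data.Nat.Combinatorics using (_C_)

-- Everything is stated over an arbitrary commutative ring R: a polynomial
-- identity in the indeterminates r, u, m (with integer coefficients) holds
-- iff it holds for all elements r, u, m of every commutative ring.
module _ {c ℓ} (R : CommutativeRing c ℓ) where
  open CommutativeRing R

  nat : ℕ → Carrier
  nat zero    = 0#
  nat (suc n) = 1# + nat n

  ∏< : ℕ → (ℕ → Carrier) → Carrier
  ∏< zero    f = 1#
  ∏< (suc n) f = ∏< n f * f n

  ∑< : ℕ → (ℕ → Carrier) → Carrier
  ∑< zero    f = 0#
  ∑< (suc n) f = ∑< n f + f n

  -- ∏[ a , b ] f = ∏_{j=a}^{b} f j  (empty product = 1 when b < a)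
  ∏[_,_] : ℕ → ℕ → (ℕ → Carrier) → Carrier
  ∏[ a , b ] f = ∏< (suc b ∸ a) (λ t → f (a ℕ.+ t))

  p : (r : Carrier) → ℕ → Carrier → Carrier
  p r k m = ∏< k (λ i → m + nat i + 1# - r)

  g : (r : Carrier) → ℕ → Carrier → ℕ → Carrier
  g r k u d = nat (d C k) * ∏< k (λ i → r + nat i)
              * ∏[ suc k , d ] (λ j → (nat d - nat j + r) * (u + nat j + r))

  N : (r : Carrier) → Carrier → ℕ → Carrier → Carrier
  N r u d m = ∑< (suc d) (λ k → g r k u d * p r k m)

  -- γ^{1,i}_k(u,d) for i = 0,1,2 (only these indices are used)
  γ1 : (r : Carrier) → ℕ → ℕ → Carrier → ℕ → Carrier
  γ1 r 0 k u d = (u + nat d - nat k - 1# + r) * (u + nat k + 1#)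
  γ1 r 1 k u d = nat 2 * nat k + nat 3 - nat d - r
  γ1 r 2 k u d = - 1#
  γ1 r (suc (suc (suc _))) k u d = 0#

-- Each summand satisfies the identity separately.  Put a = m + k + 1 − r, so that
-- p_{k+1} = p_k · a and p_{k+2} = p_k · a · (a + 1).  With s = u + k + 1 and
-- t = u + d − k − 1 + r one has u + d + m = t + a and u − m + r = s − a, hence
-- (u + d + m)(u − m + r) = ts + (s − t) a − a² = γ⁰ + γ¹ a − a (a + 1).
-- Multiplying by g_k p_k and summing over k gives the proposition.
module Submission where

open import Defs
open import Algebra.Bundles using (CommutativeRing)
open import Data.Nat as ℕ using (ℕ; zero; suc) renaming (_+_ to _+ℕ_)
import Data.Nat.Properties as ℕ
open import Data.Integer as ℤ using (ℤ; +_; -[1+_]; _⊖_; _◃_; sign; ∣_∣)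
import Data.Integer.Properties as ℤ
open import Data.Sign as Sign using (Sign)
open import Data.Maybe using (Maybe; just; nothing)
open import Relation.Nullary using (yes; no)
open import Relation.Binary.PropositionalEquality as ≡ using (_≡_)
open import Algebra.Solver.Ring.AlmostCommutativeRing
  using (_-Raw-AlmostCommutative⟶_; fromCommutativeRing)

module IntegerCoefficientSolver {c ℓ} (R : CommutativeRing c ℓ) where
  open CommutativeRing R hiding (zero)
  open import Algebra.Properties.Semiring.Mult.TCOptimised semiring
    using (_×_; ×-homo-+; ×1-homo-*; 1+×)
  open import Algebra.Properties.Ring ring using (-‿distribˡ-*; -‿distribʳ-*)
  open import Algebra.Properties.AbelianGroup +-abelianGroup using (⁻¹-∙-comm; xyx⁻¹≈y)
  open import Algebra.Properties.Group +-group using (ε⁻¹≈ε; ⁻¹-involutive; ⁻¹-anti-homo-∙)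
  open import Relation.Binary.Reasoning.Setoid setoid

  fromℤ : ℤ → Carrier
  fromℤ (+ n)    = n × 1#
  fromℤ -[1+ n ] = - (suc n × 1#)

  signed : Sign → Carrier → Carrier
  signed Sign.+ x = x
  signed Sign.- x = - x

  signed-cong : ∀ s {x y} → x ≈ y → signed s x ≈ signed s y
  signed-cong Sign.+ x≈y = x≈y
  signed-cong Sign.- x≈y = -‿cong x≈y

  signed-* : ∀ s t x y → signed (s Sign.* t) (x * y) ≈ signed s x * signed t y
  signed-* Sign.+ Sign.+ x y = refl
  signed-* Sign.+ Sign.- x y = -‿distribʳ-* x y
  signed-* Sign.- Sign.+ x y = -‿distribˡ-* x y
  signed-* Sign.- Sign.- x y = begin
    x * y         ≈⟨ ⁻¹-involutive (x * y) ⟨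
    - (- (x * y)) ≈⟨ -‿cong (-‿distribˡ-* x y) ⟩
    - (- x * y)   ≈⟨ -‿distribʳ-* (- x) y ⟩
    - x * - y     ∎

  fromℤ-◃ : ∀ s n → fromℤ (s ◃ n) ≈ signed s (n × 1#)
  fromℤ-◃ Sign.+ zero    = refl
  fromℤ-◃ Sign.- zero    = sym ε⁻¹≈ε
  fromℤ-◃ Sign.+ (suc n) = refl
  fromℤ-◃ Sign.- (suc n) = refl

  fromℤ-signAbs : ∀ i → fromℤ i ≈ signed (sign i) (∣ i ∣ × 1#)
  fromℤ-signAbs (+ n)    = refl
  fromℤ-signAbs -[1+ n ] = refl

  fromℤ-⊖ : ∀ m n → fromℤ (m ⊖ n) ≈ m × 1# - n × 1#
  fromℤ-⊖ zero    zero    = sym (-‿inverseʳ 0#)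
  fromℤ-⊖ zero    (suc n) = sym (+-identityˡ _)
  fromℤ-⊖ (suc m) zero    = sym (trans (+-congˡ ε⁻¹≈ε) (+-identityʳ _))
  fromℤ-⊖ (suc m) (suc n) = begin
    fromℤ (suc m ⊖ suc n)         ≡⟨ ≡.cong fromℤ (ℤ.[1+m]⊖[1+n]≡m⊖n m n) ⟩
    fromℤ (m ⊖ n)                 ≈⟨ fromℤ-⊖ m n ⟩
    a - b                         ≈⟨ xyx⁻¹≈y 1# (a - b) ⟨
    1# + (a - b) - 1#             ≈⟨ +-congʳ (+-assoc 1# a (- b)) ⟨
    1# + a - b - 1#               ≈⟨ +-assoc (1# + a) (- b) (- 1#) ⟩
    (1# + a) + (- b - 1#)         ≈⟨ +-congˡ (⁻¹-anti-homo-∙ 1# b) ⟨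
    (1# + a) - (1# + b)           ≈⟨ +-cong (1+× m 1#) (-‿cong (1+× n 1#)) ⟨
    suc m × 1# - suc n × 1#       ∎
    where a = m × 1#
          b = n × 1#

  fromℤ-+ : ∀ i j → fromℤ (i ℤ.+ j) ≈ fromℤ i + fromℤ j
  fromℤ-+ (+ m)    (+ n)    = ×-homo-+ 1# m n
  fromℤ-+ (+ m)    -[1+ n ] = fromℤ-⊖ m (suc n)
  fromℤ-+ -[1+ m ] (+ n)    = trans (fromℤ-⊖ n (suc m)) (+-comm _ _)
  fromℤ-+ -[1+ m ] -[1+ n ] = begin
    - (suc (suc (m ℕ.+ n)) × 1#)   ≡⟨ ≡.cong (λ k → - (suc k × 1#)) (ℕ.+-suc m n) ⟨
    - ((suc m ℕ.+ suc n) × 1#)     ≈⟨ -‿cong (×-homo-+ 1# (suc m) (suc n)) ⟩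
    - (suc m × 1# + suc n × 1#)    ≈⟨ ⁻¹-∙-comm _ _ ⟨
    - (suc m × 1#) - suc n × 1#    ∎

  fromℤ-* : ∀ i j → fromℤ (i ℤ.* j) ≈ fromℤ i * fromℤ j
  fromℤ-* i j = begin
    fromℤ (s ◃ ∣ i ∣ ℕ.* ∣ j ∣)                             ≈⟨ fromℤ-◃ s (∣ i ∣ ℕ.* ∣ j ∣) ⟩
    signed s ((∣ i ∣ ℕ.* ∣ j ∣) × 1#)                        ≈⟨ signed-cong s (×1-homo-* ∣ i ∣ ∣ j ∣) ⟩
    signed s ((∣ i ∣ × 1#) * (∣ j ∣ × 1#))                   ≈⟨ signed-* (sign i) (sign j) _ _ ⟩
    signed (sign i) (∣ i ∣ × 1#) * signed (sign j) (∣ j ∣ × 1#) ≈⟨ *-cong (fromℤ-signAbs i) (fromℤ-signAbs j) ⟨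
    fromℤ i * fromℤ j                                         ∎
    where s = sign i Sign.* sign j

  fromℤ-neg : ∀ i → fromℤ (ℤ.- i) ≈ - fromℤ i
  fromℤ-neg (+ zero)  = sym ε⁻¹≈ε
  fromℤ-neg (+ suc n) = refl
  fromℤ-neg -[1+ n ]  = sym (⁻¹-involutive _)

  fromℤ-homomorphism : ℤ.+-*-rawRing -Raw-AlmostCommutative⟶ fromCommutativeRing R
  fromℤ-homomorphism = record
    { ⟦_⟧    = fromℤ
    ; +-homo = fromℤ-+
    ; *-homo = fromℤ-*
    ; -‿homo = fromℤ-neg
    ; 0-homo = refl
    ; 1-homo = refl
    }

  fromℤ-≈? : ∀ i j → Maybe (fromℤ i ≈ fromℤ j)
  fromℤ-≈? i j with i ℤ.≟ j
  ... | yes ≡.refl = just refl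
  ... | no _       = nothing

  open import Algebra.Solver.Ring ℤ.+-*-rawRing (fromCommutativeRing R)
    fromℤ-homomorphism fromℤ-≈? public

module _ {c ℓ} (R : CommutativeRing c ℓ) where
  open CommutativeRing R hiding (zero)
  open IntegerCoefficientSolver R using (solve; _:=_; _:+_; _:*_; _:-_; :-_; con)
  open import Relation.Binary.Reasoning.Setoid setoid

  ∑<-cong : ∀ n {f h : ℕ → Carrier} → (∀ k → f k ≈ h k) → ∑< R n f ≈ ∑< R n h
  ∑<-cong zero    f≈h = refl
  ∑<-cong (suc n) f≈h = +-cong (∑<-cong n f≈h) (f≈h n)

  *-distribˡ-∑< : ∀ n x (f : ℕ → Carrier) → x * ∑< R n f ≈ ∑< R n (λ k → x * f k)
  *-distribˡ-∑< zero    x f = zeroʳ x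
  *-distribˡ-∑< (suc n) x f = trans (distribˡ x _ _) (+-congʳ (*-distribˡ-∑< n x f))

  p-recurrence : ∀ r u m d k →
    (u + nat R d + m) * (u - m + r) * p R r k m
      ≈ ∑< R 3 (λ i → γ1 R r i k u d * p R r (i +ℕ k) m)
  p-recurrence r u m d k = solve 6 (λ u m r D K P →
      (u :+ D :+ m) :* (u :- m :+ r) :* P
        := (O :+ (u :+ D :- K :- I :+ r) :* (u :+ K :+ I) :* P)
           :+ ((I :+ (I :+ O)) :* K :+ (I :+ (I :+ (I :+ O))) :- D :- r) :* (P :* (m :+ K :+ I :- r))
           :+ (:- I) :* (P :* (m :+ K :+ I :- r) :* (m :+ (I :+ K) :+ I :- r)))
    refl u m r (nat R d) (nat R k) (p R r k m)
    where O = con (+ 0)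
          I = con (+ 1)

  summand-identity : ∀ r u m d k →
    (u + nat R d + m) * (u - m + r) * (g R r k u d * p R r k m)
      ≈ ∑< R 3 (λ i → g R r k u d * γ1 R r i k u d * p R r (k +ℕ i) m)
  summand-identity r u m d k = begin
    X * (G * P k)                          ≈⟨ *-assoc X G (P k) ⟨
    X * G * P k                            ≈⟨ *-congʳ (*-comm X G) ⟩
    G * X * P k                            ≈⟨ *-assoc G X (P k) ⟩
    G * (X * P k)                          ≈⟨ *-congˡ (p-recurrence r u m d k) ⟩
    G * ∑< R 3 (λ i → Γ i * P (i +ℕ k))    ≈⟨ *-distribˡ-∑< 3 G (λ i → Γ i * P (i +ℕ k)) ⟩
    ∑< R 3 (λ i → G * (Γ i * P (i +ℕ k)))  ≈⟨ ∑<-cong 3 (λ i → sym (*-assoc G (Γ i) (P (i +ℕ k)))) ⟩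
    ∑< R 3 (λ i → G * Γ i * P (i +ℕ k))    ≈⟨ ∑<-cong 3 (λ i → reflexive (≡.cong (λ j → G * Γ i * P j) (ℕ.+-comm i k))) ⟩
    ∑< R 3 (λ i → G * Γ i * P (k +ℕ i))    ∎
    where X = (u + nat R d + m) * (u - m + r)
          G = g R r k u d
          P = λ j → p R r j m
          Γ = λ i → γ1 R r i k u d

proposition5p4 : ∀ {c ℓ} (R : CommutativeRing c ℓ) (d : ℕ) (r u m : CommutativeRing.Carrier R) →
    let open CommutativeRing R in
    (u + nat R d + m) * (u - m + r) * N R r u d m
      ≈ ∑< R (suc d) (λ k → ∑< R 3 (λ i → g R r k u d * γ1 R r i k u d * p R r (k +ℕ i) m))
proposition5p4 R d r u m =
  trans (*-distribˡ-∑< R (suc d) _ _) (∑<-cong R (suc d) (summand-identity R r u m d))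
  where open CommutativeRing R using (trans)
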